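{- Let $p_1,q_1,p_2,q_2$ be non-negative integers with $p_1>0$, $q_2>0$ and $p_1q_2-q_1p_2>0$. Let $(x,y)\in\mathcal{T}_Q$ and let $A,B$ be integers. Then $(x+Ap_1+Bp_2,\ y+Aq_1+Bq_2)\in\mathcal{B}_Q$ if and only if $(A,B)\in\mathcal{B}$, i.e. $A\ge 0$ and $B\ge 0$.
   Context: Let $\mathcal{B}$ be the set of ordered pairs of non-negative integers. Let $\mathcal{B}_Q=\{(X,Y)\in\mathcal{B}\mid Xq_1\le Yp_1 \text{ and } Yp_2\le Xq_2\}$. Let $\mathcal{T}_Q=\{(x,y)\in\mathcal{B}_Q\mid p_1(y-q_2)<q_1(x-p_2)\text{ and } p_2(y-q_1)>q_2(x-p_1)\}$. -}

module Defs where

open import Data.Nat using (ℕ)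
open import Data.Integer using (ℤ; +_; _*_; _-_; _≤_; _<_; _>_)
open import Data.Product using (_×_)

In𝓑 : ℤ → ℤ → Set
In𝓑 X Y = (+ 0 ≤ X) × (+ 0 ≤ Y)

In𝓑Q : (p₁ q₁ p₂ q₂ : ℕ) → ℤ → ℤ → Set
In𝓑Q p₁ q₁ p₂ q₂ X Y =
  In𝓑 X Y × (X * + q₁ ≤ Y * + p₁) × (Y * + p₂ ≤ X * + q₂)

In𝓣Q : (p₁ q₁ p₂ q₂ : ℕ) → ℤ → ℤ → Set
In𝓣Q p₁ q₁ p₂ q₂ x y =
  In𝓑Q p₁ q₁ p₂ q₂ x y
  × (+ p₁ * (y - + q₂) < + q₁ * (x - + p₂))
  × (+ p₂ * (y - + q₁) > + q₂ * (x - + p₁))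

-- Write D = p₁q₂ − q₁p₂ and measure a point by its two slacks σ₁ = Yp₁ − Xq₁ and
-- σ₂ = Xq₂ − Yp₂, whose non-negativity (for X, Y ≥ 0) is membership in 𝓑_Q.
-- Translating by A(p₁, q₁) + B(p₂, q₂) adds B·D to σ₁ and A·D to σ₂, while
-- (x, y) ∈ 𝓣_Q says exactly that 0 ≤ σᵢ(x, y) < D. A residue in [0, D) plus a
-- multiple B·D is non-negative iff B ≥ 0, which gives both directions.
module Submission where

open import Defs
open import Data.Nat as ℕ using (ℕ)
open import Data.Integer using (ℤ; +_; -[1+_]; _+_; _*_; _-_; -_; _≤_; _<_; _>_; +≤+; -≤-; nonNegative)
open import Data.Integer.Properties
open import Data.Integer.Tactic.RingSolver using (solve-∀)
open import Data.Product using (_,_)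
open import Function.Bundles using (_⇔_; mk⇔; module Equivalence)
open import Relation.Binary.PropositionalEquality using (_≡_; sym; subst; subst₂)
open import Relation.Nullary using (contradiction)

0≤i⇒0≤j⇒0≤i*j : ∀ {i j} → + 0 ≤ i → + 0 ≤ j → + 0 ≤ i * j
0≤i⇒0≤j⇒0≤i*j {i} {j} 0≤i 0≤j =
  subst (_≤ i * j) (*-zeroˡ j) (*-monoʳ-≤-nonNeg j {{nonNegative 0≤j}} 0≤i)

i<j⇒i-j<0 : ∀ {i j} → i < j → i - j < + 0
i<j⇒i-j<0 {i} {j} i<j = subst (i - j <_) (+-inverseʳ j) (+-monoˡ-< (- j) i<j)

0≤s+B*D⇔0≤B : ∀ {s D} B → + 0 ≤ s → s < D → (+ 0 ≤ s + B * D ⇔ + 0 ≤ B)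
0≤s+B*D⇔0≤B {s} {D} B 0≤s s<D = mk⇔ (to B) from
  where
  0≤D : + 0 ≤ D
  0≤D = ≤-trans 0≤s (<⇒≤ s<D)

  to : ∀ B → + 0 ≤ s + B * D → + 0 ≤ B
  to (+ n)    _      = +≤+ ℕ.z≤n
  to -[1+ n ] 0≤s+BD = contradiction s+BD<0 (≤⇒≯ 0≤s+BD)
    where
    BD≤-D : -[1+ n ] * D ≤ - D
    BD≤-D = subst (-[1+ n ] * D ≤_) (-1*i≡-i D)
      (*-monoʳ-≤-nonNeg D {{nonNegative 0≤D}} (-≤- {n} {0} ℕ.z≤n))

    s+BD<0 : s + -[1+ n ] * D < + 0
    s+BD<0 = ≤-<-trans (+-monoʳ-≤ s BD≤-D) (i<j⇒i-j<0 s<D)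

  from : + 0 ≤ B → + 0 ≤ s + B * D
  from 0≤B = +-mono-≤ 0≤s (0≤i⇒0≤j⇒0≤i*j 0≤B 0≤D)

j-i≡s+B*D⇒[i≤j⇔0≤B] : ∀ {i j s D} B → j - i ≡ s + B * D → + 0 ≤ s → s < D → (i ≤ j ⇔ + 0 ≤ B)
j-i≡s+B*D⇒[i≤j⇔0≤B] B j-i≡s+BD 0≤s s<D = mk⇔
  (λ i≤j → to (subst (+ 0 ≤_) j-i≡s+BD (i≤j⇒0≤j-i i≤j)))
  (λ 0≤B → 0≤i-j⇒j≤i (subst (+ 0 ≤_) (sym j-i≡s+BD) (from 0≤B)))
  where open Equivalence (0≤s+B*D⇔0≤B B 0≤s s<D)

s≡a-b+D⇒a<b⇒s<D : ∀ {a b s D} → s ≡ (a - b) + D → a < b → s < D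
s≡a-b+D⇒a<b⇒s<D {a} {b} {s} {D} s≡a-b+D a<b =
  subst₂ _<_ (sym s≡a-b+D) (+-identityˡ D) (+-monoˡ-< D (i<j⇒i-j<0 a<b))

0≤n+A*p+B*q : ∀ n p q {A B} → + 0 ≤ A → + 0 ≤ B → + 0 ≤ + n + A * + p + B * + q
0≤n+A*p+B*q n p q 0≤A 0≤B =
  +-mono-≤ (+-mono-≤ (+≤+ ℕ.z≤n) (0≤i⇒0≤j⇒0≤i*j 0≤A (+≤+ ℕ.z≤n)))
           (0≤i⇒0≤j⇒0≤i*j 0≤B (+≤+ ℕ.z≤n))

slack₁-translate : ∀ x y A B p₁ q₁ p₂ q₂ →
  (y + A * q₁ + B * q₂) * p₁ - (x + A * p₁ + B * p₂) * q₁
    ≡ (y * p₁ - x * q₁) + B * (p₁ * q₂ - q₁ * p₂)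
slack₁-translate = solve-∀

slack₂-translate : ∀ x y A B p₁ q₁ p₂ q₂ →
  (x + A * p₁ + B * p₂) * q₂ - (y + A * q₁ + B * q₂) * p₂
    ≡ (x * q₂ - y * p₂) + A * (p₁ * q₂ - q₁ * p₂)
slack₂-translate = solve-∀

slack₁-decompose : ∀ x y p₁ q₁ p₂ q₂ →
  y * p₁ - x * q₁ ≡ (p₁ * (y - q₂) - q₁ * (x - p₂)) + (p₁ * q₂ - q₁ * p₂)
slack₁-decompose = solve-∀

slack₂-decompose : ∀ x y p₁ q₁ p₂ q₂ →
  x * q₂ - y * p₂ ≡ (q₂ * (x - p₁) - p₂ * (y - q₁)) + (p₁ * q₂ - q₁ * p₂)
slack₂-decompose = solve-∀

lemma2 : (p₁ q₁ p₂ q₂ : ℕ) → + p₁ > + 0 → + q₂ > + 0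
    → + p₁ * + q₂ - + q₁ * + p₂ > + 0
    → (x y : ℕ) → In𝓣Q p₁ q₁ p₂ q₂ (+ x) (+ y)
    → (A B : ℤ)
    → In𝓑Q p₁ q₁ p₂ q₂ (+ x + A * + p₁ + B * + p₂) (+ y + A * + q₁ + B * + q₂) ⇔ In𝓑 A B
lemma2 p₁ q₁ p₂ q₂ _ _ _ x y ((_ , xq₁≤yp₁ , yp₂≤xq₂) , t₁ , t₂) A B = mk⇔
  (λ (_ , c₁ , c₂) → to cond₂ c₂ , to cond₁ c₁)
  (λ (0≤A , 0≤B) → (0≤n+A*p+B*q x p₁ p₂ 0≤A 0≤B , 0≤n+A*p+B*q y q₁ q₂ 0≤A 0≤B)
                 , from cond₁ 0≤B , from cond₂ 0≤A)
  where
  open Equivalence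
  X = + x ; Y = + y ; P₁ = + p₁ ; Q₁ = + q₁ ; P₂ = + p₂ ; Q₂ = + q₂

  cond₁ : (X + A * P₁ + B * P₂) * Q₁ ≤ (Y + A * Q₁ + B * Q₂) * P₁ ⇔ + 0 ≤ B
  cond₁ = j-i≡s+B*D⇒[i≤j⇔0≤B] B (slack₁-translate X Y A B P₁ Q₁ P₂ Q₂)
    (i≤j⇒0≤j-i xq₁≤yp₁) (s≡a-b+D⇒a<b⇒s<D (slack₁-decompose X Y P₁ Q₁ P₂ Q₂) t₁)

  cond₂ : (Y + A * Q₁ + B * Q₂) * P₂ ≤ (X + A * P₁ + B * P₂) * Q₂ ⇔ + 0 ≤ A
  cond₂ = j-i≡s+B*D⇒[i≤j⇔0≤B] A (slack₂-translate X Y A B P₁ Q₁ P₂ Q₂)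
    (i≤j⇒0≤j-i yp₂≤xq₂) (s≡a-b+D⇒a<b⇒s<D (slack₂-decompose X Y P₁ Q₁ P₂ Q₂) t₂)
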